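{- Let $r_1,r_2,r_3$ be positive integers with $r_1\ge 2$ and $\gcd(r_1,r_2)=\gcd(r_1,r_3)=1$, and suppose $r_1r_2+r_3$ is a prime number. Then there is no pair $(k_*,g_*)$ with $k_*\in\mathbb{Z}$ and $g_*$ a positive integer such that $r_1r_2+r_1^2k_*=g_*(r_3-r_1^2k_*)$ and the semigroup ${\sf S}(r_1^2,\,r_3-r_1^2k_*)$ has a nonempty set of gaps (equivalently, $r_3-r_1^2k_*\ne 1$).
   Context: For positive integers $d_1,\dots,d_m$ with $\gcd=1$, ${\sf S}(d_1,\dots,d_m)=\{\sum x_id_i : x_i\in\mathbb{Z}_{\ge0}\}$; its set of gaps is $\mathbb{Z}_{>0}\setminus{\sf S}(d_1,\dots,d_m)$. The linear dependence $r_1r_2+r_1^2k=g(r_3-r_1^2k)$ means the second generator of the triple $\{r_1^2,\,r_1r_2+r_1^2k,\,r_3-r_1^2k\}$ is a multiple of the third, so the semigroup generated by the triple reduces to ${\sf S}(r_1^2,\,r_3-r_1^2k)$. -}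

module Defs where

open import Data.Nat using (ℕ; zero; suc; _+_; _*_; _<_)
open import Data.List using (List; []; _∷_)
open import Data.Product using (Σ; _×_)
open import Relation.Binary.PropositionalEquality using (_≡_)
open import Relation.Nullary using (¬_)

-- n ∈ S(d₁,…,dₘ) : n = Σ xᵢ dᵢ for some xᵢ ∈ ℕ (coefficients chosen one generator at a time)
InS : List ℕ → ℕ → Set
InS []       n = n ≡ 0
InS (d ∷ ds) n = Σ ℕ λ x → Σ ℕ λ m → (n ≡ x * d + m) × InS ds m

IsGap : List ℕ → ℕ → Set
IsGap ds n = (0 < n) × ¬ InS ds n

HasGaps : List ℕ → Set
HasGaps ds = Σ ℕ λ n → IsGap ds n

module Submission where

-- Write d = r₃ - r₁²k.  Adding r₃ - r₁²k to both sides of the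
-- dependence r₁r₂ + r₁²k = g·d gives
--     p := r₁r₂ + r₃ = (1 + g)·d .
-- Since p and 1 + g are positive, d is a natural number n with p = (1 + g)·n.
-- As g > 0, the factor 1 + g is at least 2, so primality of p forces
-- 1 + g = p and hence n = 1.  But S(r₁², 1) is all of ℕ, so it has no gaps.
--
-- The corollary chains these four facts.

open import Defs
open import Data.Nat using (ℕ; suc; _+_; _*_; _^_; _<_; _≤_; s≤s)
open import Data.Nat.GCD using (gcd)
open import Data.Nat.Primality using (Prime; prime⇒irreducible; prime⇒nonZero)
open import Data.Nat.Divisibility using (divides)
open import Data.Integer using (ℤ; +_; -[1+_]; ∣_∣) renaming (_+_ to _+ℤ_; _*_ to _*ℤ_; _-_ to _-ℤ_)
open import Data.List using (_∷_; [])
open import Data.Product using (Σ; _×_; _,_)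
open import Data.Sum using (inj₁; inj₂)
open import Data.Empty using (⊥-elim)
open import Relation.Binary.PropositionalEquality using (_≡_; refl; sym; trans; cong; subst)
open import Relation.Nullary using (¬_)
import Data.Nat.Properties as ℕP
import Data.Integer.Properties as ℤP
open import Data.Integer.Tactic.RingSolver using (solve-∀)

dependence⇒factorisation : ∀ (x y k g : ℤ) →
  x +ℤ k ≡ g *ℤ (y -ℤ k) → x +ℤ y ≡ (+ 1 +ℤ g) *ℤ (y -ℤ k)
dependence⇒factorisation x y k g dep =
  trans (split x y k) (trans (cong (_+ℤ (y -ℤ k)) dep) (collect g (y -ℤ k)))
  where
  split : ∀ x y k → x +ℤ y ≡ (x +ℤ k) +ℤ (y -ℤ k)
  split = solve-∀
  collect : ∀ g d → g *ℤ d +ℤ d ≡ (+ 1 +ℤ g) *ℤ d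
  collect = solve-∀

-- If a natural number p equals (1 + m)·d for an integer d, then d is itself
-- a natural number n and p = (1 + m)·n in ℕ (a negative d would make the
-- product negative).
natural-cofactor : ∀ p m (d : ℤ) → + p ≡ + suc m *ℤ d →
  Σ ℕ λ n → (d ≡ + n) × (p ≡ suc m * n)
natural-cofactor p m (+ n) eq =
  n , refl , ℤP.+-injective (trans eq (sym (ℤP.pos-* (suc m) n)))
natural-cofactor p m -[1+ n ] ()

-- In a factorisation p = a·n of a prime whose first factor is at least 2,
-- irreducibility forces a = p, and cancelling p leaves n = 1.
prime-cofactor≡1 : ∀ {p a n} → Prime p → 2 ≤ a → p ≡ a * n → n ≡ 1
prime-cofactor≡1 {p} {a} {n} pr 2≤a p≡an
  with prime⇒irreducible pr (divides n (trans p≡an (ℕP.*-comm a n)))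
... | inj₁ refl = ⊥-elim (ℕP.<-irrefl refl 2≤a)
... | inj₂ refl =
  sym (ℕP.*-cancelˡ-≡ 1 n p {{prime⇒nonZero pr}} (trans (ℕP.*-identityʳ p) p≡an))

-- Every natural number m lies in S(a, 1), as m = 0·a + m·1; so S(a, 1) has
-- no gaps.
one-generator-no-gaps : ∀ a → ¬ HasGaps (a ∷ 1 ∷ [])
one-generator-no-gaps a (m , _ , m∉S) = m∉S (0 , m , refl , m , 0 , m≡m·1+0 , refl)
  where
  m≡m·1+0 : m ≡ m * 1 + 0
  m≡m·1+0 = sym (trans (ℕP.+-identityʳ (m * 1)) (ℕP.*-identityʳ m))

corollary1 : (r₁ r₂ r₃ : ℕ) → 2 ≤ r₁ → 0 < r₂ → 0 < r₃ →
    gcd r₁ r₂ ≡ 1 → gcd r₁ r₃ ≡ 1 → Prime (r₁ * r₂ + r₃) →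
    ¬ (Σ ℤ λ k → Σ ℕ λ g → (0 < g) ×
    ((+ (r₁ * r₂) +ℤ (+ (r₁ ^ 2)) *ℤ k) ≡ (+ g) *ℤ (+ r₃ -ℤ (+ (r₁ ^ 2)) *ℤ k)) ×
    HasGaps (r₁ ^ 2 ∷ ∣ + r₃ -ℤ (+ (r₁ ^ 2)) *ℤ k ∣ ∷ []))
corollary1 r₁ r₂ r₃ _ _ _ _ _ p-prime (k , g , g>0 , dependence , gaps)
  with natural-cofactor (r₁ * r₂ + r₃) g (+ r₃ -ℤ (+ (r₁ ^ 2)) *ℤ k)
         (dependence⇒factorisation (+ (r₁ * r₂)) (+ r₃) (+ (r₁ ^ 2) *ℤ k) (+ g) dependence)
... | n , d≡n , p≡[1+g]n =
  one-generator-no-gaps (r₁ ^ 2) (subst (λ t → HasGaps (r₁ ^ 2 ∷ t ∷ [])) ∣d∣≡1 gaps)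
  where
  ∣d∣≡1 : ∣ + r₃ -ℤ (+ (r₁ ^ 2)) *ℤ k ∣ ≡ 1
  ∣d∣≡1 = trans (cong ∣_∣ d≡n) (prime-cofactor≡1 p-prime (s≤s g>0) p≡[1+g]n)
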